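{- For every integer $n>4$, the star graph $K_{1,n}$ is not a $G_\phi$-graph.
   Context: $\phi$ denotes Euler's totient function, $\phi^0(n)=n$ and $\phi^i(n)=\phi(\phi^{i-1}(n))$. For a set $A$ of positive integers, $A_\phi=\{\phi^k(n): n\in A,\ k\ge 0\}$, and $G_\phi(A)$ is the simple graph with vertex set $A_\phi$ in which distinct vertices $r,s$ are adjacent iff $\phi(r)=s$ or $\phi(s)=r$. A graph $H$ is a $G_\phi$-graph if there exists a set $A$ of positive integers such that $H$ is (isomorphic to) $G_\phi(A)$. $K_{1,n}$ is the star with one center and $n$ leaves. -}

module Defs where

open import Level using (Level; suc; _⊔_)
open import Data.Nat using (ℕ; zero; _<_; _≤_)
import Data.Nat as N
open import Data.Nat.Coprimality using (Coprime; coprime?)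
open import Data.List using (List; length; filter; map; upTo)
open import Data.Fin using (Fin)
import Data.Fin as F
open import Data.Product using (Σ; ∃; _×_; _,_)
open import Data.Sum using (_⊎_)
open import Function using (_⇔_; _∘_)
open import Function.Definitions using (Injective)
open import Relation.Binary.PropositionalEquality using (_≡_; _≢_)

-- Euler's totient: φ n = #{ k ∈ {1,…,n} : gcd(k,n) = 1 }  (so φ 1 = 1, φ 0 = 0)
φ : ℕ → ℕ
φ n = length (filter (λ k → coprime? k n) (map N.suc (upTo n)))

φ^ : ℕ → ℕ → ℕ
φ^ zero    n = n
φ^ (N.suc i) n = φ (φ^ i n)

-- A_φ = { φ^k(n) : n ∈ A, k ≥ 0 }   (A given as a predicate on ℕ)
Closure : (ℕ → Set) → ℕ → Set
Closure A m = Σ ℕ λ a → Σ ℕ λ k → A a × φ^ k a ≡ m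

AdjΦ : ℕ → ℕ → Set
AdjΦ r s = r ≢ s × (φ r ≡ s ⊎ φ s ≡ r)

IsGφGraph : (V : Set) → (V → V → Set) → Set₁
IsGφGraph V E =
  Σ (ℕ → Set) λ A →
    (∀ a → A a → 0 < a) ×
    Σ (V → ℕ) λ f →
      Injective _≡_ _≡_ f ×
      (∀ v → Closure A (f v)) ×
      (∀ m → Closure A m → ∃ λ v → f v ≡ m) ×
      (∀ u v → E u v ⇔ AdjΦ (f u) (f v))

-- the star K_{1,n}: vertices Fin (n+1), centre 0, leaves 1..n
StarAdj : (n : ℕ) → Fin (N.suc n) → Fin (N.suc n) → Set
StarAdj n u v = u ≢ v × (u ≡ F.zero ⊎ v ≡ F.zero)

-- A label x ≠ 1 of G_φ(A) is adjacent to φ(x) < x, because A_φ is closed under φ. In a star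
-- this forces φ(centre) = 1 (otherwise centre, φ(centre), φ²(centre) would be a path of distinct
-- vertices whose middle is a leaf), hence centre ≤ 2, and every leaf label x ≠ 1 has
-- φ(x) = centre. So φ(x) ≤ 2 for every label x, which means x ∈ {1, 2, 3, 4, 6}: for x ≥ 7 the
-- numbers 1, x − 1 and one more residue are coprime to x. An injective labelling then leaves
-- room for at most five vertices.
module Submission where

open import Defs
open import Data.Nat using (ℕ; zero; suc; _+_; _*_; _<_; _≤_; z≤n; s≤s; s≤s⁻¹; z<s; _≤?_)
open import Data.Nat.Properties
open import Data.Nat.Coprimality using (Coprime; coprime?; 1-coprimeTo; coprime-+)
import Data.Nat.Coprimality as Coprime
open import Data.Nat.DivMod using (_%_; _/_; m%n<n; m≡m%n+[m/n]*n)
open import Data.Nat.Divisibility using (_∣_; ∣-refl; ∣1⇒≡1; ∣m+n∣m⇒∣n; ∣m⇒∣m*n)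
open import Data.Nat.Tactic.RingSolver using (solve-∀)
open import Data.Fin using (Fin; zero; suc)
open import Data.Fin.Properties using (injective⇒≤)
open import Data.List using (List; []; _∷_; length; lookup; map; filter; upTo)
open import Data.List.Properties using (length-map; length-upTo; filter-notAll)
open import Data.List.Membership.Propositional using (_∈_; lose)
open import Data.List.Membership.Propositional.Properties using (∈-lookup; ∈-map⁺; ∈-upTo⁺; ∈-filter⁺)
open import Data.List.Relation.Binary.Subset.Propositional using (_⊆_)
open import Data.List.Relation.Unary.All as All using (All; []; _∷_)
open import Data.List.Relation.Unary.Any as Any using (here; there)
open import Data.List.Relation.Unary.Any.Properties using (lookup-index)
open import Data.List.Relation.Unary.Unique.Propositional using (Unique; []; _∷_)
open import Data.Product using (∃; _×_; _,_; proj₁)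
open import Data.Sum using (inj₁; inj₂)
open import Function.Bundles using (Equivalence)
open import Function.Definitions using (Injective)
open import Relation.Nullary using (¬_; yes; no; contradiction)
open import Relation.Binary.PropositionalEquality

private
  variable
    A : Set
    V : Set
    E : V → V → Set
    m n k x : ℕ
    xs ys : List A

Unique⇒lookup-injective : Unique xs → ∀ {i j} → lookup xs i ≡ lookup xs j → i ≡ j
Unique⇒lookup-injective (_      ∷ _) {zero}  {zero}  _  = refl
Unique⇒lookup-injective (x∉xs   ∷ _) {zero}  {suc j} eq = contradiction eq (All.lookup x∉xs (∈-lookup j))
Unique⇒lookup-injective (x∉xs   ∷ _) {suc i} {zero}  eq = contradiction (sym eq) (All.lookup x∉xs (∈-lookup i))
Unique⇒lookup-injective (_ ∷ unique) {suc i} {suc j} eq = cong suc (Unique⇒lookup-injective unique eq)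

injective-into-list⇒≤ : (f : Fin m → A) → Injective _≡_ _≡_ f → (∀ i → f i ∈ xs) → m ≤ length xs
injective-into-list⇒≤ {xs = xs} f f-injective f∈xs = injective⇒≤ position-injective
  where
  open ≡-Reasoning
  position : Fin _ → Fin (length xs)
  position i = Any.index (f∈xs i)

  position-injective : Injective _≡_ _≡_ position
  position-injective {i} {j} eq = f-injective (begin
    f i                   ≡⟨ lookup-index (f∈xs i) ⟩
    lookup xs (position i) ≡⟨ cong (lookup xs) eq ⟩
    lookup xs (position j) ≡⟨ lookup-index (f∈xs j) ⟨
    f j                   ∎)

Unique-⊆⇒length≤ : Unique ys → ys ⊆ xs → length ys ≤ length xs
Unique-⊆⇒length≤ {ys = ys} unique ys⊆xs =
  injective-into-list⇒≤ (lookup ys) (Unique⇒lookup-injective unique) (λ i → ys⊆xs (∈-lookup i))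

∈-map-suc-upTo : 0 < k → k ≤ n → k ∈ map suc (upTo n)
∈-map-suc-upTo {suc k} _ k<n = ∈-map⁺ suc (∈-upTo⁺ k<n)

coprime-suc : ∀ n → Coprime n (suc n)
coprime-suc n = Coprime.sym (subst (λ m → Coprime m n) (+-comm n 1) (coprime-+ (1-coprimeTo n)))

coprimes-length≤φ : {ks : List ℕ} → Unique ks → All (λ k → 0 < k × k ≤ x × Coprime k x) ks →
                    length ks ≤ φ x
coprimes-length≤φ {x} unique ks-coprime = Unique-⊆⇒length≤ unique ks⊆coprimes
  where
  ks⊆coprimes : _ ⊆ filter (λ k → coprime? k x) (map suc (upTo x))
  ks⊆coprimes k∈ks with All.lookup ks-coprime k∈ks
  ... | 0<k , k≤x , k⊥x = ∈-filter⁺ (λ k → coprime? k x) (∈-map-suc-upTo 0<k k≤x) k⊥x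

φ-positive : 0 < x → 0 < φ x
φ-positive {x} 0<x = coprimes-length≤φ ([] ∷ []) ((z<s , 0<x , 1-coprimeTo x) ∷ [])

φ^-positive : ∀ k → 0 < x → 0 < φ^ k x
φ^-positive zero    0<x = 0<x
φ^-positive (suc k) 0<x = φ-positive (φ^-positive k 0<x)

φ-< : 1 < x → φ x < x
φ-< {x} 1<x = begin-strict
  φ x                        <⟨ filter-notAll (λ k → coprime? k x) (map suc (upTo x)) x-not-coprime ⟩
  length (map suc (upTo x))  ≡⟨ length-map suc (upTo x) ⟩
  length (upTo x)            ≡⟨ length-upTo x ⟩
  x                          ∎
  where
  open ≤-Reasoning
  x-not-coprime = lose (∈-map-suc-upTo (<-trans z<s 1<x) ≤-refl)
                       (λ x⊥x → <⇒≢ 1<x (sym (x⊥x (∣-refl , ∣-refl))))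

φ-≥2 : 2 < x → 2 ≤ φ x
φ-≥2 {suc y} (s≤s 1<y) = coprimes-length≤φ
  ((<⇒≢ 1<y ∷ []) ∷ [] ∷ [])
  ((z<s , s≤s z≤n , 1-coprimeTo (suc y)) ∷ (<-trans z<s 1<y , n≤1+n y , coprime-suc y) ∷ [])

<-by-gap : ∀ a d {y} → a + suc d ≡ y → a < y
<-by-gap a d refl = m<m+n a z<s

*≡*+1⇒coprime : ∀ {m n} u v → m * u ≡ n * v + 1 → Coprime m n
*≡*+1⇒coprime u v eq {d} (d∣m , d∣n) =
  ∣1⇒≡1 (∣m+n∣m⇒∣n (subst (d ∣_) eq (∣m⇒∣m*n u d∣m)) (∣m⇒∣m*n v d∣n))

-- The witness a for x = 7 + j: 2 if x is odd, x/2 − 1 if 4 ∣ x, and x/2 + 2 otherwise.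
coprime-strictly-between : ∀ j → ∃ λ a → 1 < a × a < 6 + j × Coprime a (7 + j)
coprime-strictly-between j = subst (λ j → ∃ λ a → 1 < a × a < 6 + j × Coprime a (7 + j))
  (sym (m≡m%n+[m/n]*n j 4)) (by-residue (j % 4) (j / 4) (m%n<n j 4))
  where
  bézout₀ : ∀ q → 2 * (4 + 2 * q) ≡ (7 + (0 + q * 4)) * 1 + 1
  bézout₀ = solve-∀
  gap₁ : ∀ q → 3 + 2 * q + suc (3 + 2 * q) ≡ 6 + (1 + q * 4)
  gap₁ = solve-∀
  bézout₁ : ∀ q → (7 + (1 + q * 4)) * (2 + q) ≡ (3 + 2 * q) * (5 + 2 * q) + 1
  bézout₁ = solve-∀
  bézout₂ : ∀ q → 2 * (5 + 2 * q) ≡ (7 + (2 + q * 4)) * 1 + 1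
  bézout₂ = solve-∀
  gap₃ : ∀ q → 7 + 2 * q + suc (1 + 2 * q) ≡ 6 + (3 + q * 4)
  gap₃ = solve-∀
  bézout₃ : ∀ q → (7 + 2 * q) * (23 + 14 * q + 2 * (q * q))
                ≡ (7 + (3 + q * 4)) * ((4 + q) * (4 + q)) + 1
  bézout₃ = solve-∀

  by-residue : ∀ r q → r < 4 → ∃ λ a → 1 < a × a < 6 + (r + q * 4) × Coprime a (7 + (r + q * 4))
  by-residue 0 q _ = 2 , ≤-refl , s≤s (s≤s (s≤s z≤n)) , *≡*+1⇒coprime (4 + 2 * q) 1 (bézout₀ q)
  by-residue 1 q _ = 3 + 2 * q , s≤s (s≤s z≤n) , <-by-gap (3 + 2 * q) (3 + 2 * q) (gap₁ q) ,
                     Coprime.sym (*≡*+1⇒coprime (2 + q) (5 + 2 * q) (bézout₁ q))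
  by-residue 2 q _ = 2 , ≤-refl , s≤s (s≤s (s≤s z≤n)) , *≡*+1⇒coprime (5 + 2 * q) 1 (bézout₂ q)
  by-residue 3 q _ = 7 + 2 * q , s≤s (s≤s z≤n) , <-by-gap (7 + 2 * q) (1 + 2 * q) (gap₃ q) ,
                     *≡*+1⇒coprime (23 + 14 * q + 2 * (q * q)) ((4 + q) * (4 + q)) (bézout₃ q)
  by-residue (suc (suc (suc (suc _)))) _ (s≤s (s≤s (s≤s (s≤s ()))))

φ-≥3 : 7 ≤ x → 3 ≤ φ x
φ-≥3 7≤x with j , refl ← m≤n⇒∃[o]m+o≡n 7≤x =
  let a , 1<a , a<y , a⊥x = coprime-strictly-between j in
  coprimes-length≤φ
    ((<⇒≢ 1<a ∷ <⇒≢ (<-trans 1<a a<y) ∷ []) ∷ (<⇒≢ a<y ∷ []) ∷ [] ∷ [])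
    (  (z<s , s≤s z≤n , 1-coprimeTo (7 + j))
     ∷ (<-trans z<s 1<a , m<n⇒m≤1+n a<y , a⊥x)
     ∷ (z<s , n≤1+n (6 + j) , coprime-suc (6 + j))
     ∷ [])

φ≡1⇒≤2 : φ x ≡ 1 → x ≤ 2
φ≡1⇒≤2 {x} φx≡1 with x ≤? 2
... | yes x≤2 = x≤2
... | no  x≰2 = contradiction (subst (2 ≤_) φx≡1 (φ-≥2 (≰⇒> x≰2))) λ { (s≤s ()) }

φ≤2⇒∈ : 0 < x → φ x ≤ 2 → x ∈ 1 ∷ 2 ∷ 3 ∷ 4 ∷ 6 ∷ []
φ≤2⇒∈ {1} _ _ = here refl
φ≤2⇒∈ {2} _ _ = there (here refl)
φ≤2⇒∈ {3} _ _ = there (there (here refl))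
φ≤2⇒∈ {4} _ _ = there (there (there (here refl)))
φ≤2⇒∈ {5} _ (s≤s (s≤s ()))
φ≤2⇒∈ {6} _ _ = there (there (there (there (here refl))))
φ≤2⇒∈ {(suc (suc (suc (suc (suc (suc (suc j)))))))} _ φx≤2 = contradiction φx≤2 (<⇒≱ (φ-≥3 (m≤m+n 7 j)))

label : IsGφGraph V E → V → ℕ
label (_ , _ , f , _) = f

label-injective : (G : IsGφGraph V E) → Injective _≡_ _≡_ (label G)
label-injective (_ , _ , _ , f-injective , _) = f-injective

label-positive : (G : IsGφGraph V E) → ∀ v → 0 < label G v
label-positive (_ , positive , _ , _ , into , _) v with a , k , a∈A , φᵏa≡fv ← into v =
  subst (0 <_) φᵏa≡fv (φ^-positive k (positive a a∈A))

label-≢1⇒>1 : (G : IsGφGraph V E) → ∀ v → label G v ≢ 1 → 1 < label G v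
label-≢1⇒>1 G v v≢1 with label G v | label-positive G v
... | suc zero    | _ = contradiction refl v≢1
... | suc (suc _) | _ = s≤s (s≤s z≤n)

totient-neighbour : (G : IsGφGraph V E) → ∀ v → label G v ≢ 1 → ∃ λ w → label G w ≡ φ (label G v) × E v w
totient-neighbour G@(_ , _ , f , _ , into , onto , adjacency) v v≢1
  with a , k , a∈A , φᵏa≡fv ← into v
  with w , fw≡φfv ← onto (φ (f v)) (a , suc k , a∈A , cong φ φᵏa≡fv)
  = w , fw≡φfv , Equivalence.from (adjacency v w) (fv≢fw , inj₁ (sym fw≡φfv))
  where
  fv≢fw : f v ≢ f w
  fv≢fw fv≡fw = <⇒≢ (φ-< (label-≢1⇒>1 G v v≢1)) (trans (sym fw≡φfv) (sym fv≡fw))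

star-path-centre : ∀ {u v w} → StarAdj n u v → StarAdj n v w → u ≢ w → v ≡ zero
star-path-centre (_ , inj₂ v≡0)  _               _   = v≡0
star-path-centre (_ , inj₁ refl) (_ , inj₁ v≡0)  _   = v≡0
star-path-centre (_ , inj₁ refl) (_ , inj₂ refl) u≢w = contradiction refl u≢w

star-leaf-neighbour : ∀ {i v} → StarAdj n (suc i) v → v ≡ zero
star-leaf-neighbour (_ , inj₂ v≡0) = v≡0

star-centre-φ≡1 : (G : IsGφGraph (Fin (suc n)) (StarAdj n)) → φ (label G zero) ≡ 1
star-centre-φ≡1 G with label G zero ≟ 1
... | yes c≡1 = cong φ c≡1
... | no  c≢1 with totient-neighbour G zero c≢1
... | w , fw≡φc , c–w with label G w ≟ 1
... | yes w≡1 = trans (sym fw≡φc) w≡1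
... | no  w≢1 with totient-neighbour G w w≢1
... | u , fu≡φw , w–u = contradiction (star-path-centre c–w w–u c≢u) (≢-sym (proj₁ c–w))
  where
  open ≤-Reasoning
  fu<fc : label G u < label G zero
  fu<fc = begin-strict
    label G u          ≡⟨ fu≡φw ⟩
    φ (label G w)      <⟨ φ-< (label-≢1⇒>1 G w w≢1) ⟩
    label G w          ≡⟨ fw≡φc ⟩
    φ (label G zero)   <⟨ φ-< (label-≢1⇒>1 G zero c≢1) ⟩
    label G zero       ∎
  c≢u : zero ≢ u
  c≢u refl = <-irrefl refl fu<fc

star-leaf-φ≡centre : (G : IsGφGraph (Fin (suc n)) (StarAdj n)) →
                     ∀ i → label G (suc i) ≢ 1 → φ (label G (suc i)) ≡ label G zero
star-leaf-φ≡centre G i leaf≢1 with w , fw≡φleaf , leaf–w ← totient-neighbour G (suc i) leaf≢1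
  rewrite star-leaf-neighbour leaf–w = sym fw≡φleaf

star-φ≤2 : (G : IsGφGraph (Fin (suc n)) (StarAdj n)) → ∀ v → φ (label G v) ≤ 2
star-φ≤2 G zero = subst (_≤ 2) (sym (star-centre-φ≡1 G)) (s≤s z≤n)
star-φ≤2 G (suc i) with label G (suc i) ≟ 1
... | yes leaf≡1 = subst (λ x → φ x ≤ 2) (sym leaf≡1) (s≤s z≤n)
... | no  leaf≢1 = subst (_≤ 2) (sym (star-leaf-φ≡centre G i leaf≢1)) (φ≡1⇒≤2 (star-centre-φ≡1 G))

theorem2p9 : (n : ℕ) → 4 < n → ¬ IsGφGraph (Fin (suc n)) (StarAdj n)
theorem2p9 n 4<n G = <⇒≱ 4<n (s≤s⁻¹ at-most-five-vertices)
  where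
  at-most-five-vertices : suc n ≤ 5
  at-most-five-vertices = injective-into-list⇒≤ (label G) (label-injective G)
    (λ v → φ≤2⇒∈ (label-positive G v) (star-φ≤2 G v))
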